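{- For all $n\ge0$, $H_3^{\lceil n/2\rceil}\subseteq P^n\subseteq H_4^n$, i.e. $P^n$ contains a subgraph isomorphic to $H_3^{\lceil n/2\rceil}$ and $P^n$ is a subgraph of $H_4^n$.
   Context: For $m\ge3$, the Hanoi graph $H_m^n$ has vertex set $\{0,\dots,m-1\}^n$ (words $s_n\cdots s_1$, $s_d$ the peg of disc $d$), two words being adjacent iff they differ in exactly one coordinate $d$, with values $i\ne j$ there, and $s_k\notin\{i,j\}$ for all $k<d$. The parity-constrained Hanoi graph $P^n$: with $p(d)=1$ for even $d$, $p(d)=2$ for odd $d$, and $Q^d=\{0,p(d),3\}$, its vertices are the words $s\in\{0,1,2,3\}^n$ with $s_d\in Q^d$ for all $d$, and two vertices are adjacent iff they differ in exactly one coordinate $d$, with values $i\ne j$ there, $i,j\in Q^d$, and $s_k\notin\{i,j\}$ for all $k<d$. Graphs with $n=0$ have one vertex. -}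

module Defs where

open import Data.Nat using (ℕ; zero; suc; _<_)
open import Data.Fin using (Fin; toℕ)
open import Data.Vec using (Vec; lookup)
open import Data.Product using (Σ; _×_; proj₁)
open import Data.Sum using (_⊎_)
open import Relation.Binary.PropositionalEquality using (_≡_; _≢_)
open import Function.Definitions using (Injective)

record Graph : Set₁ where
  field
    V   : Set
    Adj : V → V → Set
open Graph public

_↪_ : Graph → Graph → Set
G ↪ H = Σ (V G → V H) λ f →
          Injective _≡_ _≡_ f × (∀ u v → Adj G u v → Adj H (f u) (f v))

-- Words s = s_n ⋯ s_1 over pegs {0,…,m-1}; position i : Fin n is disc d = toℕ i + 1.
Word : ℕ → ℕ → Set
Word m n = Vec (Fin m) n

HanoiAdj : ∀ m n → Word m n → Word m n → Set
HanoiAdj m n s t = Σ (Fin n) λ d →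
    (lookup s d ≢ lookup t d)
  × (∀ e → e ≢ d → lookup s e ≡ lookup t e)
  × (∀ k → toℕ k < toℕ d → lookup s k ≢ lookup s d × lookup s k ≢ lookup t d)

H : ℕ → ℕ → Graph
H m n = record { V = Word m n ; Adj = HanoiAdj m n }

-- p(d) for disc d = i + 1 (i = position index): p(d) = 2 for odd d, 1 for even d.
pIdx : ℕ → Fin 4
pIdx zero = Fin.suc (Fin.suc Fin.zero)
pIdx (suc zero) = Fin.suc Fin.zero
pIdx (suc (suc k)) = pIdx k

InQ : ℕ → Fin 4 → Set
InQ i x = (x ≡ Fin.zero) ⊎ (x ≡ pIdx i) ⊎ (x ≡ Fin.suc (Fin.suc (Fin.suc Fin.zero)))

PVert : ℕ → Set
PVert n = Σ (Word 4 n) λ s → ∀ (d : Fin n) → InQ (toℕ d) (lookup s d)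

PAdj : ∀ n → PVert n → PVert n → Set
PAdj n s t = Σ (Fin n) λ d →
    (lookup (proj₁ s) d ≢ lookup (proj₁ t) d)
  × InQ (toℕ d) (lookup (proj₁ s) d) × InQ (toℕ d) (lookup (proj₁ t) d)
  × (∀ e → e ≢ d → lookup (proj₁ s) e ≡ lookup (proj₁ t) e)
  × (∀ k → toℕ k < toℕ d → lookup (proj₁ s) k ≢ lookup (proj₁ s) d
                         × lookup (proj₁ s) k ≢ lookup (proj₁ t) d)

P : ℕ → Graph
P n = record { V = PVert n ; Adj = PAdj n }

-- Number the discs 1, …, n. The odd discs carry a copy of a three-peg tower on the pegs
-- {0, 2, 3} = Q^d, while every even disc is parked on peg 1 ∈ Q^d.
module Submission where

open import Defs
open import Data.Nat using (ℕ; zero; suc; _<_; s≤s; z≤n; ⌈_/2⌉)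
open import Data.Fin using (Fin; toℕ) renaming (zero to fz; suc to fs)
open import Data.Vec using ([]; _∷_; lookup)
open import Data.Vec.Properties using (∷-injective)
open import Data.Product using (∃; _×_; _,_; proj₁; proj₂)
open import Data.Sum using (_⊎_; inj₁; inj₂)
open import Function using (_∘_)
open import Function.Definitions using (Injective)
open import Relation.Binary.PropositionalEquality

PAdj⇒HanoiAdj : ∀ n (s t : PVert n) → PAdj n s t → HanoiAdj 4 n (proj₁ s) (proj₁ t)
PAdj⇒HanoiAdj n s t (d , s≢t , _ , _ , others≡ , smaller-free) = d , s≢t , others≡ , smaller-free

HanoiAdj⇒PAdj : ∀ n (s t : PVert n) → HanoiAdj 4 n (proj₁ s) (proj₁ t) → PAdj n s t
HanoiAdj⇒PAdj n (s , s∈Q) (t , t∈Q) (d , s≢t , others≡ , smaller-free) =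
  d , s≢t , s∈Q d , t∈Q d , others≡ , smaller-free

module Interleave {m m′ : ℕ} (f : Fin m → Fin m′) (c : Fin m′) where

  -- Position i carries disc i + 1, so the odd discs sit at the even positions.
  interleave : ∀ n → Word m ⌈ n /2⌉ → Word m′ n
  interleave zero          []       = []
  interleave (suc zero)    (x ∷ []) = f x ∷ []
  interleave (suc (suc n)) (x ∷ xs) = f x ∷ c ∷ interleave n xs

  oddDisc : ∀ n → Fin ⌈ n /2⌉ → Fin n
  oddDisc (suc zero)    fz     = fz
  oddDisc (suc (suc n)) fz     = fz
  oddDisc (suc (suc n)) (fs d) = fs (fs (oddDisc n d))

  lookup-oddDisc : ∀ n w d → lookup (interleave n w) (oddDisc n d) ≡ f (lookup w d)
  lookup-oddDisc (suc zero)    (x ∷ []) fz     = refl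
  lookup-oddDisc (suc (suc n)) (x ∷ xs) fz     = refl
  lookup-oddDisc (suc (suc n)) (x ∷ xs) (fs d) = lookup-oddDisc n xs d

  oddDisc-or-parked : ∀ n (e : Fin n) →
    (∃ λ d → e ≡ oddDisc n d) ⊎ (∀ w → lookup (interleave n w) e ≡ c)
  oddDisc-or-parked (suc zero)    fz          = inj₁ (fz , refl)
  oddDisc-or-parked (suc (suc n)) fz          = inj₁ (fz , refl)
  oddDisc-or-parked (suc (suc n)) (fs fz)     = inj₂ λ { (_ ∷ _) → refl }
  oddDisc-or-parked (suc (suc n)) (fs (fs e)) with oddDisc-or-parked n e
  ... | inj₁ (d , e≡) = inj₁ (fs d , cong (fs ∘ fs) e≡)
  ... | inj₂ parked   = inj₂ λ { (_ ∷ xs) → parked xs }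

  oddDisc-reflects-< : ∀ n k d → toℕ (oddDisc n k) < toℕ (oddDisc n d) → toℕ k < toℕ d
  oddDisc-reflects-< (suc zero)    fz     fz     ()
  oddDisc-reflects-< (suc (suc n)) fz     fz     ()
  oddDisc-reflects-< (suc (suc n)) fz     (fs d) _                 = s≤s z≤n
  oddDisc-reflects-< (suc (suc n)) (fs k) fz     ()
  oddDisc-reflects-< (suc (suc n)) (fs k) (fs d) (s≤s (s≤s k<d)) = s≤s (oddDisc-reflects-< n k d k<d)

  module _ (f-injective : Injective _≡_ _≡_ f) where

    interleave-injective : ∀ n → Injective _≡_ _≡_ (interleave n)
    interleave-injective zero          {[]}     {[]}     _  = refl
    interleave-injective (suc zero)    {x ∷ []} {y ∷ []} eq =
      cong (_∷ []) (f-injective (proj₁ (∷-injective eq)))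
    interleave-injective (suc (suc n)) {x ∷ xs} {y ∷ ys} eq =
      cong₂ _∷_ (f-injective (proj₁ (∷-injective eq)))
                (interleave-injective n (proj₂ (∷-injective (proj₂ (∷-injective eq)))))

    lookup-oddDisc-injective : ∀ n w w′ k d →
      lookup (interleave n w) (oddDisc n k) ≡ lookup (interleave n w′) (oddDisc n d) →
      lookup w k ≡ lookup w′ d
    lookup-oddDisc-injective n w w′ k d eq =
      f-injective (trans (sym (lookup-oddDisc n w k)) (trans eq (lookup-oddDisc n w′ d)))

    interleave-preserves-HanoiAdj : (∀ x → c ≢ f x) → ∀ n w w′ →
      HanoiAdj m ⌈ n /2⌉ w w′ → HanoiAdj m′ n (interleave n w) (interleave n w′)
    interleave-preserves-HanoiAdj c∉f n w w′ (d , w≢w′ , others≡ , smaller-free) =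
      oddDisc n d , w≢w′ ∘ lookup-oddDisc-injective n w w′ d d , others≡′ , smaller-free′
      where
      others≡′ : ∀ e → e ≢ oddDisc n d → lookup (interleave n w) e ≡ lookup (interleave n w′) e
      others≡′ e e≢d with oddDisc-or-parked n e
      ... | inj₁ (k , refl) = begin
        lookup (interleave n w) (oddDisc n k)  ≡⟨ lookup-oddDisc n w k ⟩
        f (lookup w k)                         ≡⟨ cong f (others≡ k (e≢d ∘ cong (oddDisc n))) ⟩
        f (lookup w′ k)                        ≡⟨ lookup-oddDisc n w′ k ⟨
        lookup (interleave n w′) (oddDisc n k) ∎
        where open ≡-Reasoning
      ... | inj₂ parked = trans (parked w) (sym (parked w′))

      parked-≢ : ∀ {e} v → lookup (interleave n w) e ≡ c →
                 lookup (interleave n w) e ≢ lookup (interleave n v) (oddDisc n d)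
      parked-≢ v e≡c eq = c∉f (lookup v d) (trans (sym e≡c) (trans eq (lookup-oddDisc n v d)))

      smaller-free′ : ∀ e → toℕ e < toℕ (oddDisc n d) →
          lookup (interleave n w) e ≢ lookup (interleave n w) (oddDisc n d)
        × lookup (interleave n w) e ≢ lookup (interleave n w′) (oddDisc n d)
      smaller-free′ e e<d with oddDisc-or-parked n e
      ... | inj₁ (k , refl) =
        let (k≢d , k≢d′) = smaller-free k (oddDisc-reflects-< n k d e<d)
        in  k≢d ∘ lookup-oddDisc-injective n w w k d , k≢d′ ∘ lookup-oddDisc-injective n w w′ k d
      ... | inj₂ parked = parked-≢ w (parked w) , parked-≢ w′ (parked w)

-- Q^d = {0, 2, 3} for odd d, i.e. at even positions.
oddQ : Fin 3 → Fin 4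
oddQ fz           = fz
oddQ (fs fz)      = fs (fs fz)
oddQ (fs (fs fz)) = fs (fs (fs fz))

peg₁ : Fin 4
peg₁ = fs fz

oddQ-injective : Injective _≡_ _≡_ oddQ
oddQ-injective {fz}         {fz}         _ = refl
oddQ-injective {fs fz}      {fs fz}      _ = refl
oddQ-injective {fs (fs fz)} {fs (fs fz)} _ = refl
oddQ-injective {fz}         {fs fz}      ()
oddQ-injective {fz}         {fs (fs fz)} ()
oddQ-injective {fs fz}      {fz}         ()
oddQ-injective {fs fz}      {fs (fs fz)} ()
oddQ-injective {fs (fs fz)} {fz}         ()
oddQ-injective {fs (fs fz)} {fs fz}      ()

peg₁∉oddQ : ∀ x → peg₁ ≢ oddQ x
peg₁∉oddQ fz           ()
peg₁∉oddQ (fs fz)      ()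
peg₁∉oddQ (fs (fs fz)) ()

oddQ-InQ : ∀ x → InQ 0 (oddQ x)
oddQ-InQ fz           = inj₁ refl
oddQ-InQ (fs fz)      = inj₂ (inj₁ refl)
oddQ-InQ (fs (fs fz)) = inj₂ (inj₂ refl)

open Interleave oddQ peg₁

interleave-InQ : ∀ n w (e : Fin n) → InQ (toℕ e) (lookup (interleave n w) e)
interleave-InQ (suc zero)    (x ∷ []) fz          = oddQ-InQ x
interleave-InQ (suc (suc n)) (x ∷ xs) fz          = oddQ-InQ x
interleave-InQ (suc (suc n)) (x ∷ xs) (fs fz)     = inj₂ (inj₁ refl)
interleave-InQ (suc (suc n)) (x ∷ xs) (fs (fs e)) = interleave-InQ n xs e

H3-↪-P : ∀ n → H 3 ⌈ n /2⌉ ↪ P n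
H3-↪-P n = embed , embed-injective , embed-adj
  where
  embed : Word 3 ⌈ n /2⌉ → PVert n
  embed w = interleave n w , interleave-InQ n w

  embed-injective : Injective _≡_ _≡_ embed
  embed-injective = interleave-injective oddQ-injective n ∘ cong proj₁

  embed-adj : ∀ w w′ → HanoiAdj 3 ⌈ n /2⌉ w w′ → PAdj n (embed w) (embed w′)
  embed-adj w w′ = HanoiAdj⇒PAdj n (embed w) (embed w′)
                 ∘ interleave-preserves-HanoiAdj oddQ-injective peg₁∉oddQ n w w′

theorem6p12 : ∀ (n : ℕ) →
    (H 3 ⌈ n /2⌉ ↪ P n)
    × (∀ (s t : PVert n) → PAdj n s t → HanoiAdj 4 n (proj₁ s) (proj₁ t))
theorem6p12 n = H3-↪-P n , PAdj⇒HanoiAdj n
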